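{- Let $d\geq 3$, let $G$ be a $d$-regular graph, let $v$ be a vertex of $G$, and let $C$ be the vertex set of the connected component of $G$ containing $v$, with $|C|\geq 2(d+1)$. Suppose $u\in V_1$ satisfies $\mathrm{d}'(u)=0$ (i.e. $u$ has no neighbour in $V_1$). Then there is a sequence of at most two $\Delta$-switches transforming $G$ into a graph $G'$ with ${\rm N}_{G'}(v)={\rm N}_G(v)$ such that the edge set of $G'[V_1]$ equals $E_1\cup\{uw\}$ for some $w\in V_1$; that is, an edge of $G[V_1]$ incident with $u$ is inserted without altering any other edge of $E_1$.
   Context: All graphs are simple. Layering from $v$: for $i\ge0$, $V_i$ is the set of vertices of $C$ at distance exactly $i$ from $v$ (so $V_0=\{v\}$, $V_1={\rm N}(v)$); $G_i=G[V_i]$ has edge set $E_i$. For $u\in V_i$, $\mathrm{d}'(u)=|{\rm N}(u)\cap V_i|$. A $\Delta^+$-switch in a graph $G=(V,E)$: if $p,x,y,w,z$ are distinct vertices such that $yx, xp, pw, wz\in E$ and $xw, yz\notin E$, delete the edges $xy$, $wz$ and insert $xw$, $yz$. A $\Delta^-$-switch is the reverse: if $p,x,y,w,z$ are distinct, $G$ contains the triangle on $p,x,w$ and the edge $yz$, and $xy, wz\notin E$, delete $xw$, $yz$ and insert $xy$, $wz$. A $\Delta$-switch is either of these. -}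

module Defs where

open import Data.Nat using (ℕ; zero; suc; _+_; _*_; _≥_)
open import Data.Bool using (Bool; true; false; if_then_else_; _∧_; _∨_)
open import Data.Fin using (Fin; _≟_)
open import Data.List using (List; map; allFin)
open import Data.Nat.ListAction using (sum)
open import Data.Product using (Σ; ∃; ∃-syntax; _×_; _,_)
open import Data.Sum using (_⊎_)
open import Relation.Nullary using (¬_)
open import Relation.Nullary.Decidable using (⌊_⌋)
open import Relation.Binary.PropositionalEquality using (_≡_; _≢_)
open import Function.Definitions using (Injective)

Adj : ℕ → Set
Adj n = Fin n → Fin n → Bool

record IsSimple {n : ℕ} (G : Adj n) : Set where
  field
    sym    : ∀ a b → G a b ≡ G b a
    irrefl : ∀ a → G a a ≡ false

deg : {n : ℕ} → Adj n → Fin n → ℕ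
deg {n} G x = sum (map (λ a → if G x a then 1 else 0) (allFin n))

Regular : {n : ℕ} → ℕ → Adj n → Set
Regular d G = ∀ x → deg G x ≡ d

data Reach {n : ℕ} (G : Adj n) (a : Fin n) : Fin n → Set where
  here : Reach G a a
  step : ∀ {b c} → Reach G a b → G b c ≡ true → Reach G a c

CompAtLeast : {n : ℕ} → Adj n → Fin n → ℕ → Set
CompAtLeast {n} G v m =
  Σ (Fin m → Fin n) λ f → Injective _≡_ _≡_ f × (∀ i → Reach G v (f i))

isPair : {n : ℕ} → Fin n → Fin n → Fin n → Fin n → Bool
isPair a b s t = (⌊ a ≟ s ⌋ ∧ ⌊ b ≟ t ⌋) ∨ (⌊ a ≟ t ⌋ ∧ ⌊ b ≟ s ⌋)

Rewired : {n : ℕ} → Adj n → Adj n →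
          (s₁ t₁ s₂ t₂ q₁ r₁ q₂ r₂ : Fin n) → Set
Rewired G H s₁ t₁ s₂ t₂ q₁ r₁ q₂ r₂ = ∀ a b → H a b ≡
  (if isPair a b s₁ t₁ ∨ isPair a b s₂ t₂ then false
   else if isPair a b q₁ r₁ ∨ isPair a b q₂ r₂ then true
   else G a b)

Distinct5 : {n : ℕ} → (p x y w z : Fin n) → Set
Distinct5 p x y w z =
  p ≢ x × p ≢ y × p ≢ w × p ≢ z × x ≢ y × x ≢ w × x ≢ z ×
  y ≢ w × y ≢ z × w ≢ z

Δ⁺Switch : {n : ℕ} → Adj n → Adj n → Set
Δ⁺Switch {n} G H = Σ (Fin n) λ p → Σ (Fin n) λ x → Σ (Fin n) λ y →
  Σ (Fin n) λ w → Σ (Fin n) λ z →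
    Distinct5 p x y w z ×
    G y x ≡ true × G x p ≡ true × G p w ≡ true × G w z ≡ true ×
    G x w ≡ false × G y z ≡ false ×
    Rewired G H x y w z x w y z

Δ⁻Switch : {n : ℕ} → Adj n → Adj n → Set
Δ⁻Switch {n} G H = Σ (Fin n) λ p → Σ (Fin n) λ x → Σ (Fin n) λ y →
  Σ (Fin n) λ w → Σ (Fin n) λ z →
    Distinct5 p x y w z ×
    G p x ≡ true × G x w ≡ true × G p w ≡ true × G y z ≡ true ×
    G x y ≡ false × G w z ≡ false ×
    Rewired G H x w y z x y w z

ΔSwitch : {n : ℕ} → Adj n → Adj n → Set
ΔSwitch G H = Δ⁺Switch G H ⊎ Δ⁻Switch G H

-- G' is obtained from G by a sequence of at most two Δ-switches
-- (equality of graphs is pointwise equality of adjacency)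
AtMostTwoΔ : {n : ℕ} → Adj n → Adj n → Set
AtMostTwoΔ {n} G G' =
  (∀ a b → G' a b ≡ G a b)
  ⊎ ΔSwitch G G'
  ⊎ (Σ (Adj n) λ H → ΔSwitch G H × ΔSwitch H G')

-- Let W = V₁ − u, Y = N(u) − v ⊆ V₂, and call an edge wz with w ∈ W and z ∈ V₂ outer.
-- If some outer edge wz and some y ∈ Y − z have yz ∉ E, the Δ⁺-switch along y u v w z
-- inserts uw. Otherwise every y ∈ Y is adjacent to every outer z ≠ y, and then degree counting
-- gives N(z) ⊆ Y ∪ {u, w}; consequently either all outer vertices lie in Y or none does.
-- In the first case N[v] ∪ Y is closed under adjacency and has at most 2d vertices,
-- contradicting |C| ≥ 2(d + 1). In the second, counting yields w₁, w₂ ∈ W adjacent and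
-- y ∈ Y with yw₁ ∉ E; the switch along y u v w₂ w₁ followed by the one along z₂ w₂ v w₁ z₁
-- (z₁, z₂ outer neighbours of w₁, w₂) inserts uw₂ and leaves every other edge of G[V₁] intact.
module Submission where

open import Defs
open import Data.Bool using (Bool; true; false; if_then_else_; _∧_; _∨_; not)
open import Data.Bool.Properties using (¬-not; ∨-zeroʳ; ∧-zeroʳ) renaming (_≟_ to _≟ᵇ_)
open import Data.Fin using (Fin; zero; suc; _≟_)
open import Data.Fin.Properties using (any?; suc-injective)
open import Data.List using (tabulate)
open import Data.List.Properties using (map-tabulate)
open import Data.Nat using (ℕ; zero; suc; _+_; _*_; _≤_; _<_; _≥_; z≤n; s≤s)
open import Data.Nat.ListAction using (sum)
open import Data.Nat.Properties
  using (≤-trans; ≤-reflexive; ≤-pred; <⇒≱; n≤1+n; n<1+n; n≮n; +-suc; +-monoˡ-≤; +-monoʳ-≤; module ≤-Reasoning)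
  renaming (suc-injective to ℕ-suc-injective)
open import Data.Nat.Tactic.RingSolver using (solve-∀)
open import Data.Product using (Σ; ∃; _×_; _,_; proj₁; proj₂)
open import Data.Sum using (_⊎_; inj₁; inj₂)
open import Function.Base using (_∘_; id; case_of_)
open import Function.Bundles using (_⇔_; mk⇔)
open import Relation.Binary.PropositionalEquality
  using (_≡_; _≢_; refl; sym; trans; cong; subst; ≢-sym; module ≡-Reasoning)
open import Relation.Nullary using (¬_; Dec; does; yes; no; contradiction)
open import Relation.Nullary.Decidable using (⌊_⌋; isYes≗does; dec-true; dec-false; _×-dec_; ¬?)

VSet : ℕ → Set
VSet n = Fin n → Bool

module _ {n : ℕ} where

  infix  4 _∈_ _∉_ _⊆_ _∈?_
  infixr 6 _∪_
  infixl 7 _-_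

  _∈_ : Fin n → VSet n → Set
  a ∈ p = p a ≡ true

  _∉_ : Fin n → VSet n → Set
  a ∉ p = ¬ a ∈ p

  _∈?_ : (a : Fin n) (p : VSet n) → Dec (a ∈ p)
  a ∈? p = p a ≟ᵇ true

  _⊆_ : VSet n → VSet n → Set
  p ⊆ q = ∀ a → a ∈ p → a ∈ q

  -- These use does rather than ⌊_⌋ (which is stuck on suc x ≟ suc y), and _-_ tests first,
  -- so that ⁅ suc x ⁆ ∘ suc, (p - zero) ∘ suc and (⁅ zero ⁆ ∪ p) ∘ suc reduce as the
  -- counting lemmas need.
  ⁅_⁆ : Fin n → VSet n
  ⁅ x ⁆ a = does (a ≟ x)

  _∪_ : VSet n → VSet n → VSet n
  (p ∪ q) a = p a ∨ q a

  _-_ : VSet n → Fin n → VSet n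
  (p - x) a = not (does (a ≟ x)) ∧ p a

  ∁ : VSet n → VSet n
  ∁ p a = not (p a)

x∈⁅x⁆ : {n : ℕ} (x : Fin n) → x ∈ ⁅ x ⁆
x∈⁅x⁆ x = dec-true (x ≟ x) refl

module _ {n : ℕ} {x : Fin n} where

  x∈⁅y⁆⇒x≡y : (y : Fin n) → x ∈ ⁅ y ⁆ → x ≡ y
  x∈⁅y⁆⇒x≡y y h with x ≟ y
  ... | yes x≡y = x≡y

  x∈p∪q⁺ : (p q : VSet n) → x ∈ p ⊎ x ∈ q → x ∈ p ∪ q
  x∈p∪q⁺ p q (inj₁ x∈p) rewrite x∈p = refl
  x∈p∪q⁺ p q (inj₂ x∈q) rewrite x∈q = ∨-zeroʳ (p x)

  x∈p∪q⁻ : (p q : VSet n) → x ∈ p ∪ q → x ∈ p ⊎ x ∈ q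
  x∈p∪q⁻ p q h with p x
  ... | true  = inj₁ refl
  ... | false = inj₂ h

  x∈p∧x≢y⇒x∈p-y : (p : VSet n) {y : Fin n} → x ∈ p → x ≢ y → x ∈ p - y
  x∈p∧x≢y⇒x∈p-y p {y} x∈p x≢y rewrite dec-false (x ≟ y) x≢y = x∈p

  x∈p-y⇒x≢y : (p : VSet n) (y : Fin n) → x ∈ p - y → x ≢ y
  x∈p-y⇒x≢y p y h with x ≟ y
  ... | no x≢y = x≢y

  x∉p⇒x∈∁p : (p : VSet n) → x ∉ p → x ∈ ∁ p
  x∉p⇒x∈∁p p x∉p = cong not (¬-not x∉p)

  x∈∁p⇒x∉p : (p : VSet n) → x ∈ ∁ p → x ∉ p
  x∈∁p⇒x∉p p h x∈p rewrite x∈p with () ← h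

  x∉∁p⇒x∈p : (p : VSet n) → x ∉ ∁ p → x ∈ p
  x∉∁p⇒x∈p p h with p x
  ... | true  = refl
  ... | false = contradiction refl h

  x∈p∧y∉p⇒x≢y : (p : VSet n) {y : Fin n} → x ∈ p → y ∉ p → x ≢ y
  x∈p∧y∉p⇒x≢y p x∈p y∉p refl = y∉p x∈p

module _ {n : ℕ} where

  p⊆p∪q : (p q : VSet n) → p ⊆ p ∪ q
  p⊆p∪q p q a = x∈p∪q⁺ p q ∘ inj₁

  q⊆p∪q : (p q : VSet n) → q ⊆ p ∪ q
  q⊆p∪q p q a = x∈p∪q⁺ p q ∘ inj₂

  ∪-⊆ : (p q r : VSet n) → p ⊆ r → q ⊆ r → p ∪ q ⊆ r
  ∪-⊆ p q r p⊆r q⊆r a h with x∈p∪q⁻ p q h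
  ... | inj₁ a∈p = p⊆r a a∈p
  ... | inj₂ a∈q = q⊆r a a∈q

  ⁅x⁆⊆p : {x : Fin n} (p : VSet n) → x ∈ p → ⁅ x ⁆ ⊆ p
  ⁅x⁆⊆p {x} p x∈p a h = subst (_∈ p) (sym (x∈⁅y⁆⇒x≡y x h)) x∈p

  ∪-monoʳ : (p q r : VSet n) → q ⊆ r → p ∪ q ⊆ p ∪ r
  ∪-monoʳ p q r q⊆r = ∪-⊆ p q (p ∪ r) (p⊆p∪q p r) (λ a → q⊆p∪q p r a ∘ q⊆r a)

  p-x⊆p : (p : VSet n) (x : Fin n) → p - x ⊆ p
  p-x⊆p p x a h with a ≟ x
  ... | no _ = h

∣_∣ : {n : ℕ} → VSet n → ℕ
∣_∣ {zero}  p = 0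
∣_∣ {suc n} p = (if p zero then 1 else 0) + ∣ p ∘ suc ∣

∣∅∣≡0 : {n : ℕ} → ∣ (λ (_ : Fin n) → false) ∣ ≡ 0
∣∅∣≡0 {zero}  = refl
∣∅∣≡0 {suc n} = ∣∅∣≡0 {n}

∣⊤∣≡n : {n : ℕ} → ∣ (λ (_ : Fin n) → true) ∣ ≡ n
∣⊤∣≡n {zero}  = refl
∣⊤∣≡n {suc n} = cong suc (∣⊤∣≡n {n})

∣⁅x⁆∣≡1 : {n : ℕ} (x : Fin n) → ∣ ⁅ x ⁆ ∣ ≡ 1
∣⁅x⁆∣≡1 {suc n} zero    = cong suc (∣∅∣≡0 {n})
∣⁅x⁆∣≡1 {suc n} (suc x) = ∣⁅x⁆∣≡1 x

∣p∪q∣≤∣p∣+∣q∣ : {n : ℕ} (p q : VSet n) → ∣ p ∪ q ∣ ≤ ∣ p ∣ + ∣ q ∣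
∣p∪q∣≤∣p∣+∣q∣ {zero}  p q = z≤n
∣p∪q∣≤∣p∣+∣q∣ {suc n} p q with p zero | q zero | ∣p∪q∣≤∣p∣+∣q∣ (p ∘ suc) (q ∘ suc)
... | true  | true  | ih = s≤s (≤-trans ih (+-monoʳ-≤ ∣ p ∘ suc ∣ (n≤1+n ∣ q ∘ suc ∣)))
... | true  | false | ih = s≤s ih
... | false | true  | ih = ≤-trans (s≤s ih) (≤-reflexive (sym (+-suc ∣ p ∘ suc ∣ ∣ q ∘ suc ∣)))
... | false | false | ih = ih

x∈p⇒∣p∣≡1+∣p-x∣ : {n : ℕ} (p : VSet n) {x : Fin n} → x ∈ p → ∣ p ∣ ≡ suc ∣ p - x ∣
x∈p⇒∣p∣≡1+∣p-x∣ {suc n} p {zero}  x∈p rewrite x∈p = refl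
x∈p⇒∣p∣≡1+∣p-x∣ {suc n} p {suc x} x∈p =
  trans (cong ((if p zero then 1 else 0) +_) (x∈p⇒∣p∣≡1+∣p-x∣ (p ∘ suc) x∈p)) (+-suc _ _)

x∉p⇒∣⁅x⁆∪p∣≡1+∣p∣ : {n : ℕ} (p : VSet n) {x : Fin n} → x ∉ p → ∣ ⁅ x ⁆ ∪ p ∣ ≡ suc ∣ p ∣
x∉p⇒∣⁅x⁆∪p∣≡1+∣p∣ {suc n} p {zero}  x∉p rewrite ¬-not x∉p = refl
x∉p⇒∣⁅x⁆∪p∣≡1+∣p∣ {suc n} p {suc x} x∉p =
  trans (cong ((if p zero then 1 else 0) +_) (x∉p⇒∣⁅x⁆∪p∣≡1+∣p∣ (p ∘ suc) x∉p)) (+-suc _ _)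

∣⁅x⁆∪p∣≤1+∣p∣ : {n : ℕ} (x : Fin n) (p : VSet n) → ∣ ⁅ x ⁆ ∪ p ∣ ≤ suc ∣ p ∣
∣⁅x⁆∪p∣≤1+∣p∣ x p = subst (λ k → ∣ ⁅ x ⁆ ∪ p ∣ ≤ k + ∣ p ∣) (∣⁅x⁆∣≡1 x) (∣p∪q∣≤∣p∣+∣q∣ ⁅ x ⁆ p)

∣p∣>0⇒nonempty : {n : ℕ} (p : VSet n) → 0 < ∣ p ∣ → ∃ λ x → x ∈ p
∣p∣>0⇒nonempty {suc n} p h with p zero in p0
... | true  = zero , p0
... | false with ∣p∣>0⇒nonempty (p ∘ suc) h
...   | x , x∈p = suc x , x∈p

∣p∣≤∣q∣-injection : {m n : ℕ} (p : VSet m) (q : VSet n)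
  (f : ∀ a → a ∈ p → Fin n) → (∀ a (a∈p : a ∈ p) → f a a∈p ∈ q) →
  (∀ a b (a∈p : a ∈ p) (b∈p : b ∈ p) → f a a∈p ≡ f b b∈p → a ≡ b) →
  ∣ p ∣ ≤ ∣ q ∣
∣p∣≤∣q∣-injection {zero} p q f f∈q f-inj = z≤n
∣p∣≤∣q∣-injection {suc m} p q f f∈q f-inj with p zero in p0
... | true  = ≤-trans (s≤s (∣p∣≤∣q∣-injection (p ∘ suc) (q - f zero p0) (λ a → f (suc a)) f-suc∈q-f₀ f-suc-inj))
                      (≤-reflexive (sym (x∈p⇒∣p∣≡1+∣p-x∣ q (f∈q zero p0))))
  where
  f-suc∈q-f₀ : ∀ a (a∈p : suc a ∈ p) → f (suc a) a∈p ∈ q - f zero p0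
  f-suc∈q-f₀ a a∈p = x∈p∧x≢y⇒x∈p-y q (f∈q (suc a) a∈p) λ eq → case f-inj (suc a) zero a∈p p0 eq of λ ()
  f-suc-inj : ∀ a b (a∈p : suc a ∈ p) (b∈p : suc b ∈ p) → f (suc a) a∈p ≡ f (suc b) b∈p → a ≡ b
  f-suc-inj a b a∈p b∈p eq = suc-injective (f-inj (suc a) (suc b) a∈p b∈p eq)
... | false = ∣p∣≤∣q∣-injection (p ∘ suc) q (λ a → f (suc a)) (λ a → f∈q (suc a))
                (λ a b a∈p b∈p eq → suc-injective (f-inj (suc a) (suc b) a∈p b∈p eq))

p⊆q⇒∣p∣≤∣q∣ : {n : ℕ} (p q : VSet n) → p ⊆ q → ∣ p ∣ ≤ ∣ q ∣
p⊆q⇒∣p∣≤∣q∣ p q p⊆q = ∣p∣≤∣q∣-injection p q (λ a _ → a) p⊆q (λ _ _ _ _ → id)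

p⊆q∧∣q∣≤∣p∣⇒q⊆p : {n : ℕ} (p q : VSet n) → p ⊆ q → ∣ q ∣ ≤ ∣ p ∣ → q ⊆ p
p⊆q∧∣q∣≤∣p∣⇒q⊆p p q p⊆q ∣q∣≤∣p∣ a a∈q with a ∈? p
... | yes a∈p = a∈p
... | no  a∉p = contradiction (begin-strict
      ∣ p ∣             <⟨ n<1+n ∣ p ∣ ⟩
      suc ∣ p ∣         ≡⟨ x∉p⇒∣⁅x⁆∪p∣≡1+∣p∣ p a∉p ⟨
      ∣ ⁅ a ⁆ ∪ p ∣     ≤⟨ p⊆q⇒∣p∣≤∣q∣ _ q (∪-⊆ ⁅ a ⁆ p q (⁅x⁆⊆p q a∈q) p⊆q) ⟩
      ∣ q ∣             ≤⟨ ∣q∣≤∣p∣ ⟩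
      ∣ p ∣             ∎) (n≮n ∣ p ∣)
  where open ≤-Reasoning

sum-indicator≡∣p∣ : {n : ℕ} (p : VSet n) → sum (tabulate (λ a → if p a then 1 else 0)) ≡ ∣ p ∣
sum-indicator≡∣p∣ {zero}  p = refl
sum-indicator≡∣p∣ {suc n} p = cong ((if p zero then 1 else 0) +_) (sum-indicator≡∣p∣ (p ∘ suc))

deg≡∣N∣ : {n : ℕ} (G : Adj n) (x : Fin n) → deg G x ≡ ∣ G x ∣
deg≡∣N∣ G x = trans (cong sum (map-tabulate id (λ a → if G x a then 1 else 0))) (sum-indicator≡∣p∣ (G x))

Closed : {n : ℕ} → Adj n → VSet n → Set
Closed G S = ∀ {b c} → b ∈ S → c ∈ G b → c ∈ S

Reach⇒∈closed : {n : ℕ} {G : Adj n} {S : VSet n} {v t : Fin n} →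
  Closed G S → v ∈ S → Reach G v t → t ∈ S
Reach⇒∈closed closed v∈S here       = v∈S
Reach⇒∈closed closed v∈S (step r e) = closed (Reach⇒∈closed closed v∈S r) e

CompAtLeast⇒≤∣closed∣ : {n m : ℕ} {G : Adj n} {v : Fin n} (S : VSet n) →
  CompAtLeast G v m → Closed G S → v ∈ S → m ≤ ∣ S ∣
CompAtLeast⇒≤∣closed∣ {m = m} S (f , f-inj , reach) closed v∈S =
  subst (_≤ ∣ S ∣) (∣⊤∣≡n {m})
    (∣p∣≤∣q∣-injection (λ _ → true) S (λ i _ → f i)
      (λ i _ → Reach⇒∈closed closed v∈S (reach i)) (λ _ _ _ _ → f-inj))

module _ {n : ℕ} where

  ⌊x≟x⌋ : (x : Fin n) → ⌊ x ≟ x ⌋ ≡ true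
  ⌊x≟x⌋ x = trans (isYes≗does (x ≟ x)) (dec-true (x ≟ x) refl)

  ⌊x≟y⌋≡false : {x y : Fin n} → x ≢ y → ⌊ x ≟ y ⌋ ≡ false
  ⌊x≟y⌋≡false {x} {y} x≢y = trans (isYes≗does (x ≟ y)) (dec-false (x ≟ y) x≢y)

isPair-refl : {n : ℕ} (s t : Fin n) → isPair s t s t ≡ true
isPair-refl s t rewrite ⌊x≟x⌋ s | ⌊x≟x⌋ t = refl

module _ {n : ℕ} {a b s t : Fin n} where

  isPair-∉ˡ : a ≢ s → a ≢ t → isPair a b s t ≡ false
  isPair-∉ˡ a≢s a≢t rewrite ⌊x≟y⌋≡false a≢s | ⌊x≟y⌋≡false a≢t = refl

  isPair-∉ʳ : b ≢ s → b ≢ t → isPair a b s t ≡ false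
  isPair-∉ʳ b≢s b≢t rewrite ⌊x≟y⌋≡false b≢s | ⌊x≟y⌋≡false b≢t
                          | ∧-zeroʳ ⌊ a ≟ s ⌋ | ∧-zeroʳ ⌊ a ≟ t ⌋ = refl

  isPair-∌₁ : a ≢ s → b ≢ s → isPair a b s t ≡ false
  isPair-∌₁ a≢s b≢s rewrite ⌊x≟y⌋≡false a≢s | ⌊x≟y⌋≡false b≢s = ∧-zeroʳ ⌊ a ≟ t ⌋

  isPair-∌₂ : a ≢ t → b ≢ t → isPair a b s t ≡ false
  isPair-∌₂ a≢t b≢t rewrite ⌊x≟y⌋≡false a≢t | ⌊x≟y⌋≡false b≢t | ∧-zeroʳ ⌊ a ≟ s ⌋ = refl

  isPair⇒≡ : isPair a b s t ≡ true → (a ≡ s × b ≡ t) ⊎ (a ≡ t × b ≡ s)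
  isPair⇒≡ h with a ≟ s | b ≟ t | a ≟ t | b ≟ s
  ... | yes a≡s | yes b≡t | _       | _       = inj₁ (a≡s , b≡t)
  ... | _       | _       | yes a≡t | yes b≡s = inj₂ (a≡t , b≡s)
  ... | yes _   | no _    | yes _   | no _    = case h of λ ()
  ... | yes _   | no _    | no _    | _       = case h of λ ()
  ... | no _    | _       | yes _   | no _    = case h of λ ()
  ... | no _    | _       | no _    | _       = case h of λ ()

switch : {n : ℕ} → Adj n → (x y w z : Fin n) → Adj n
switch G x y w z a b =
  if isPair a b x y ∨ isPair a b w z then false
  else if isPair a b x w ∨ isPair a b y z then true
  else G a b

switch-removes : {n : ℕ} (G : Adj n) (x y w z : Fin n) → switch G x y w z w z ≡ false
switch-removes G x y w z rewrite isPair-refl w z | ∨-zeroʳ (isPair w z x y) = refl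

module _ {n : ℕ} (G : Adj n) {x y w z : Fin n} where

  switch-Δ⁺ : (p : Fin n) → Distinct5 p x y w z →
    G y x ≡ true → G x p ≡ true → G p w ≡ true → G w z ≡ true →
    G x w ≡ false → G y z ≡ false → Δ⁺Switch G (switch G x y w z)
  switch-Δ⁺ p distinct yx xp pw wz xw yz =
    p , x , y , w , z , distinct , yx , xp , pw , wz , xw , yz , λ _ _ → refl

  module _ {a b : Fin n} where

    switch-untouchedˡ : a ≢ x → a ≢ y → a ≢ w → a ≢ z → switch G x y w z a b ≡ G a b
    switch-untouchedˡ a≢x a≢y a≢w a≢z
      rewrite isPair-∉ˡ {b = b} a≢x a≢y | isPair-∉ˡ {b = b} a≢w a≢z
            | isPair-∉ˡ {b = b} a≢x a≢w | isPair-∉ˡ {b = b} a≢y a≢z = refl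

    switch-untouchedʳ : b ≢ x → b ≢ y → b ≢ w → b ≢ z → switch G x y w z a b ≡ G a b
    switch-untouchedʳ b≢x b≢y b≢w b≢z
      rewrite isPair-∉ʳ {a = a} b≢x b≢y | isPair-∉ʳ {a = a} b≢w b≢z
            | isPair-∉ʳ {a = a} b≢x b≢w | isPair-∉ʳ {a = a} b≢y b≢z = refl

    switch-∌y : a ≢ y → b ≢ y →
      switch G x y w z a b ≡ (if isPair a b w z then false else isPair a b x w ∨ G a b)
    switch-∌y a≢y b≢y rewrite isPair-∌₂ {s = x} a≢y b≢y | isPair-∌₁ {t = z} a≢y b≢y
      with isPair a b w z | isPair a b x w
    ... | true  | _     = refl
    ... | false | true  = refl
    ... | false | false = refl

    switch-∌yz : a ≢ y → b ≢ y → a ≢ z → b ≢ z → switch G x y w z a b ≡ isPair a b x w ∨ G a b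
    switch-∌yz a≢y b≢y a≢z b≢z rewrite switch-∌y a≢y b≢y | isPair-∌₂ {s = w} a≢z b≢z = refl

≡∨⇒⇔ : {x p g : Bool} → x ≡ p ∨ g → (x ≡ true ⇔ (g ≡ true ⊎ p ≡ true))
≡∨⇒⇔ {p = true}  refl = mk⇔ (λ _ → inj₂ refl) (λ _ → refl)
≡∨⇒⇔ {p = false} refl = mk⇔ inj₁ λ { (inj₁ g) → g ; (inj₂ ()) }

1+m+k<2[m+1] : {m k : ℕ} → suc k ≡ m → suc m + k < 2 * (m + 1)
1+m+k<2[m+1] {k = k} refl = subst (suc (suc k) + k <_) (sym (2[k+2]≡4+2k k)) (s≤s (n≤1+n _))
  where
  2[k+2]≡4+2k : ∀ k → 2 * (suc k + 1) ≡ suc (suc (suc (suc k) + k))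
  2[k+2]≡4+2k = solve-∀

∨-if-restore : {p r : Bool} → (p ≡ true → r ≡ true) → p ∨ (if p then false else r) ≡ r
∨-if-restore {true}  p⇒r = sym (p⇒r refl)
∨-if-restore {false} _   = refl

module IsolatedNeighbour
  {n : ℕ} (G : Adj n) (simple : IsSimple G) {d : ℕ} (regular : Regular d G)
  (v u : Fin n) (v~u : G v u ≡ true) (u-isolated : ∀ a → G v a ≡ true → G u a ≡ false)
  where

  N : Fin n → VSet n
  N = G

  N[v] W Y Out : VSet n
  N[v] = ⁅ v ⁆ ∪ N v
  W    = N v - u
  Y    = N u - v
  Out  = ∁ N[v]

  N-sym : ∀ {a b} → a ∈ N b → b ∈ N a
  N-sym {a} {b} = trans (IsSimple.sym simple a b)

  ≁-sym : ∀ {a b} → G a b ≡ false → G b a ≡ false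
  ≁-sym {a} {b} = trans (IsSimple.sym simple b a)

  N-irrefl : ∀ {a} → a ∉ N a
  N-irrefl {a} a~a with () ← trans (sym a~a) (IsSimple.irrefl simple a)

  N⇒≢ : ∀ {a b} → b ∈ N a → a ≢ b
  N⇒≢ b~a refl = N-irrefl b~a

  N[v]∩N[u]≡∅ : ∀ {a} → a ∈ N v → a ∉ N u
  N[v]∩N[u]≡∅ {a} a∈N a∈Nu with () ← trans (sym a∈Nu) (u-isolated a a∈N)

  isPair-adj : ∀ {a b s t} → isPair a b s t ≡ true → t ∈ N s → b ∈ N a
  isPair-adj {a} {b} {s} {t} pair t~s with isPair⇒≡ {a = a} {b} {s} {t} pair
  ... | inj₁ (refl , refl) = t~s
  ... | inj₂ (refl , refl) = N-sym t~s

  ∣N∣≡d : ∀ x → ∣ N x ∣ ≡ d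
  ∣N∣≡d x = trans (sym (deg≡∣N∣ G x)) (regular x)

  ∣p∣≤d : ∀ {x} (p : VSet n) → p ⊆ N x → ∣ p ∣ ≤ d
  ∣p∣≤d {x} p p⊆N = subst (∣ p ∣ ≤_) (∣N∣≡d x) (p⊆q⇒∣p∣≤∣q∣ p (N x) p⊆N)

  d≤∣p∣ : ∀ {x} (p : VSet n) → N x ⊆ p → d ≤ ∣ p ∣
  d≤∣p∣ {x} p N⊆p = subst (_≤ ∣ p ∣) (∣N∣≡d x) (p⊆q⇒∣p∣≤∣q∣ (N x) p N⊆p)

  N-saturated : ∀ {x} (p : VSet n) → p ⊆ N x → d ≤ ∣ p ∣ → N x ⊆ p
  N-saturated {x} p p⊆N d≤∣p∣ = p⊆q∧∣q∣≤∣p∣⇒q⊆p p (N x) p⊆N (subst (_≤ ∣ p ∣) (sym (∣N∣≡d x)) d≤∣p∣)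

  1+∣W∣≡d : suc ∣ W ∣ ≡ d
  1+∣W∣≡d = trans (sym (x∈p⇒∣p∣≡1+∣p-x∣ (N v) v~u)) (∣N∣≡d v)

  1+∣Y∣≡d : suc ∣ Y ∣ ≡ d
  1+∣Y∣≡d = trans (sym (x∈p⇒∣p∣≡1+∣p-x∣ (N u) (N-sym v~u))) (∣N∣≡d u)

  ∣W∣≡∣Y∣ : ∣ W ∣ ≡ ∣ Y ∣
  ∣W∣≡∣Y∣ = ℕ-suc-injective (trans 1+∣W∣≡d (sym 1+∣Y∣≡d))

  W⊆N : W ⊆ N v
  W⊆N = p-x⊆p (N v) u

  Y⊆N : Y ⊆ N u
  Y⊆N = p-x⊆p (N u) v

  W⇒≢u : ∀ {w} → w ∈ W → w ≢ u
  W⇒≢u = x∈p-y⇒x≢y (N v) u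

  Y⇒≢v : ∀ {y} → y ∈ Y → y ≢ v
  Y⇒≢v = x∈p-y⇒x≢y (N u) v

  Out⇒∉N : ∀ {z} → z ∈ Out → z ∉ N v
  Out⇒∉N {z} z∈Out = x∈∁p⇒x∉p N[v] z∈Out ∘ q⊆p∪q ⁅ v ⁆ (N v) z

  Out⇒≢v : ∀ {z} → z ∈ Out → z ≢ v
  Out⇒≢v z∈Out refl = x∈∁p⇒x∉p N[v] z∈Out (p⊆p∪q ⁅ v ⁆ (N v) v (x∈⁅x⁆ v))

  N∧Out⇒≢ : ∀ {a z} → a ∈ N v → z ∈ Out → a ≢ z
  N∧Out⇒≢ a∈N z∈Out = x∈p∧y∉p⇒x≢y (N v) a∈N (Out⇒∉N z∈Out)

  Y⊆Out : Y ⊆ Out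
  Y⊆Out y y∈Y = x∉p⇒x∈∁p N[v] λ y∈N[v] → case x∈p∪q⁻ ⁅ v ⁆ (N v) y∈N[v] of λ where
    (inj₁ y≡v) → Y⇒≢v y∈Y (x∈⁅y⁆⇒x≡y v y≡v)
    (inj₂ y∈N) → N[v]∩N[u]≡∅ y∈N (Y⊆N y y∈Y)

  W⇒∉Y : ∀ {w} → w ∈ W → w ∉ Y
  W⇒∉Y {w} w∈W w∈Y = Out⇒∉N (Y⊆Out w w∈Y) (W⊆N w w∈W)

  vertex-cases : ∀ a → a ≡ v ⊎ a ≡ u ⊎ a ∈ W ⊎ a ∈ Out
  vertex-cases a with a ∈? Out
  ... | yes a∈Out = inj₂ (inj₂ (inj₂ a∈Out))
  ... | no  a∉Out with x∈p∪q⁻ ⁅ v ⁆ (N v) (x∉∁p⇒x∈p N[v] a∉Out)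
  ...   | inj₁ a≡v = inj₁ (x∈⁅y⁆⇒x≡y v a≡v)
  ...   | inj₂ a∈N with u ≟ a
  ...     | yes u≡a = inj₂ (inj₁ (sym u≡a))
  ...     | no  u≢a = inj₂ (inj₂ (inj₁ (x∈p∧x≢y⇒x∈p-y (N v) a∈N (≢-sym u≢a))))

  Insertion : Set
  Insertion = Σ (Adj n) λ G' → AtMostTwoΔ G G' ×
    (∀ a → G' v a ≡ G v a) ×
    Σ (Fin n) λ w → G v w ≡ true × w ≢ u ×
      (∀ a b → G v a ≡ true → G v b ≡ true →
        (G' a b ≡ true ⇔ (G a b ≡ true ⊎ isPair a b u w ≡ true)))

  insertion : (G' : Adj n) → AtMostTwoΔ G G' → (∀ a → G' v a ≡ G v a) → ∀ {w} → w ∈ W →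
    (∀ {a b} → a ∈ N v → b ∈ N v → G' a b ≡ isPair a b u w ∨ G a b) → Insertion
  insertion G' steps row {w} w∈W on-N =
    G' , steps , row , w , W⊆N w w∈W , W⇒≢u w∈W , λ a b a∈N b∈N → ≡∨⇒⇔ (on-N a∈N b∈N)

  -- An edge from V₁ − u to V₂: Out is everything outside N[v], and Y ⊆ V₂.
  OuterEdge : Fin n → Fin n → Set
  OuterEdge w z = w ∈ W × z ∈ N w × z ∈ Out

  outer-exists : ∀ {w} → w ∈ W → ∃ (OuterEdge w)
  outer-exists {w} w∈W with any? (λ z → z ∈? N w ×-dec z ∈? Out)
  ... | yes (z , w~z , z∈Out) = z , w∈W , w~z , z∈Out
  ... | no  ∄ = contradiction (begin-strict
        ∣ W ∣             <⟨ n<1+n ∣ W ∣ ⟩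
        suc ∣ W ∣         ≡⟨ 1+∣W∣≡d ⟩
        d                 ≤⟨ d≤∣p∣ (⁅ v ⁆ ∪ W - w) N[w]⊆ ⟩
        ∣ ⁅ v ⁆ ∪ W - w ∣ ≤⟨ ∣⁅x⁆∪p∣≤1+∣p∣ v (W - w) ⟩
        suc ∣ W - w ∣     ≡⟨ x∈p⇒∣p∣≡1+∣p-x∣ W w∈W ⟨
        ∣ W ∣             ∎) (n≮n ∣ W ∣)
    where
    open ≤-Reasoning
    N[w]⊆ : N w ⊆ ⁅ v ⁆ ∪ W - w
    N[w]⊆ a a~w with vertex-cases a
    ... | inj₁ refl                = p⊆p∪q ⁅ v ⁆ (W - w) v (x∈⁅x⁆ v)
    ... | inj₂ (inj₁ refl)         = contradiction (N-sym a~w) (N[v]∩N[u]≡∅ (W⊆N w w∈W))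
    ... | inj₂ (inj₂ (inj₁ a∈W))   = q⊆p∪q ⁅ v ⁆ (W - w) a (x∈p∧x≢y⇒x∈p-y W a∈W (≢-sym (N⇒≢ a~w)))
    ... | inj₂ (inj₂ (inj₂ a∈Out)) = contradiction (a , a~w , a∈Out) ∄

  outer : ∀ {w} → w ∈ W → Fin n
  outer = proj₁ ∘ outer-exists

  outer-edge : ∀ {w} (w∈W : w ∈ W) → OuterEdge w (outer w∈W)
  outer-edge = proj₂ ∘ outer-exists

  switch-at-u : ∀ {w z y} → w ∈ W → z ∈ N w → z ≢ v → z ≢ u → y ∈ Y → y ≢ z → G y z ≡ false →
    Δ⁺Switch G (switch G u y w z)
  switch-at-u {w} {z} {y} w∈W w~z z≢v z≢u y∈Y y≢z y≁z =
    switch-Δ⁺ G v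
      (N⇒≢ v~u , ≢-sym (Y⇒≢v y∈Y) , N⇒≢ w∈N , ≢-sym z≢v , N⇒≢ (Y⊆N y y∈Y) , ≢-sym (W⇒≢u w∈W) ,
       ≢-sym z≢u , ≢-sym (N∧Out⇒≢ w∈N (Y⊆Out y y∈Y)) , y≢z , N⇒≢ w~z)
      (N-sym (Y⊆N y y∈Y)) (N-sym v~u) w∈N w~z (u-isolated w w∈N) y≁z
    where
    w∈N : w ∈ N v
    w∈N = W⊆N w w∈W

  switch-at-u-fixes-v : ∀ {w z y a} → w ∈ W → z ≢ v → y ∈ Y → switch G u y w z v a ≡ G v a
  switch-at-u-fixes-v {w} w∈W z≢v y∈Y =
    switch-untouchedˡ G (N⇒≢ v~u) (≢-sym (Y⇒≢v y∈Y)) (N⇒≢ (W⊆N w w∈W)) (≢-sym z≢v)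

  single-switch : ∀ {w z y} → OuterEdge w z → y ∈ Y → y ≢ z → G y z ≡ false → Insertion
  single-switch {w} {z} {y} (w∈W , w~z , z∈Out) y∈Y y≢z y≁z =
    insertion (switch G u y w z)
      (inj₂ (inj₁ (inj₁ (switch-at-u w∈W w~z (Out⇒≢v z∈Out) (≢-sym (N∧Out⇒≢ v~u z∈Out)) y∈Y y≢z y≁z))))
      (λ _ → switch-at-u-fixes-v w∈W (Out⇒≢v z∈Out) y∈Y) w∈W
      λ a∈N b∈N → switch-∌yz G (≢y a∈N) (≢y b∈N) (N∧Out⇒≢ a∈N z∈Out) (N∧Out⇒≢ b∈N z∈Out)
    where
    ≢y : ∀ {a} → a ∈ N v → a ≢ y
    ≢y a∈N = N∧Out⇒≢ a∈N (Y⊆Out y y∈Y)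

  -- The first switch inserts uw₂ and yw₁ at the expense of w₁w₂, the second one restores w₁w₂.
  double-switch : ∀ {w₁ z₁ w₂ z₂ y} → OuterEdge w₁ z₁ → OuterEdge w₂ z₂ → w₂ ∈ N w₁ →
    z₁ ∉ Y → z₂ ∉ Y → z₁ ≢ z₂ → G z₁ z₂ ≡ false → y ∈ Y → G y w₁ ≡ false → Insertion
  double-switch {w₁} {z₁} {w₂} {z₂} {y} (w₁∈W , w₁~z₁ , z₁∈Out) (w₂∈W , w₂~z₂ , z₂∈Out)
                w₁~w₂ z₁∉Y z₂∉Y z₁≢z₂ z₁≁z₂ y∈Y y≁w₁ =
    insertion G' (inj₂ (inj₂ (H , inj₁ Δ₁ , inj₁ Δ₂))) row w₂∈W on-N
    where
    H G' : Adj n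
    H  = switch G u y w₂ w₁
    G' = switch H w₂ z₂ w₁ z₁
    w₁∈N : w₁ ∈ N v
    w₁∈N = W⊆N w₁ w₁∈W
    w₂∈N : w₂ ∈ N v
    w₂∈N = W⊆N w₂ w₂∈W
    w₁≢v : w₁ ≢ v
    w₁≢v = ≢-sym (N⇒≢ w₁∈N)
    ≢z : ∀ {a z} → a ∈ N v → z ∈ Out → z ≢ a
    ≢z a∈N z∈Out = ≢-sym (N∧Out⇒≢ a∈N z∈Out)
    ≢y : ∀ {a} → a ∈ N v → a ≢ y
    ≢y a∈N = N∧Out⇒≢ a∈N (Y⊆Out y y∈Y)
    untouched-by-H : ∀ {z} → z ∈ Out → z ∉ Y → z ≢ u × z ≢ y × z ≢ w₂ × z ≢ w₁
    untouched-by-H z∈Out z∉Y =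
      ≢z v~u z∈Out , ≢-sym (x∈p∧y∉p⇒x≢y Y y∈Y z∉Y) , ≢z w₂∈N z∈Out , ≢z w₁∈N z∈Out
    H-row : ∀ {z b} → z ∈ Out → z ∉ Y → H z b ≡ G z b
    H-row z∈Out z∉Y with untouched-by-H z∈Out z∉Y
    ... | z≢u , z≢y , z≢w₂ , z≢w₁ = switch-untouchedˡ G z≢u z≢y z≢w₂ z≢w₁
    H-column : ∀ {a z} → z ∈ Out → z ∉ Y → H a z ≡ G a z
    H-column z∈Out z∉Y with untouched-by-H z∈Out z∉Y
    ... | z≢u , z≢y , z≢w₂ , z≢w₁ = switch-untouchedʳ G z≢u z≢y z≢w₂ z≢w₁
    Δ₁ : Δ⁺Switch G H
    Δ₁ = switch-at-u w₂∈W (N-sym w₁~w₂) w₁≢v (W⇒≢u w₁∈W) y∈Y (≢-sym (≢y w₁∈N)) y≁w₁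
    Δ₂ : Δ⁺Switch H G'
    Δ₂ = switch-Δ⁺ H v
           (N⇒≢ w₂∈N , ≢-sym (Out⇒≢v z₂∈Out) , N⇒≢ w₁∈N , ≢-sym (Out⇒≢v z₁∈Out) ,
            N∧Out⇒≢ w₂∈N z₂∈Out , N⇒≢ (N-sym w₁~w₂) , N∧Out⇒≢ w₂∈N z₁∈Out , ≢z w₁∈N z₂∈Out ,
            ≢-sym z₁≢z₂ , N∧Out⇒≢ w₁∈N z₁∈Out)
           (trans (H-row z₂∈Out z₂∉Y) (N-sym w₂~z₂))
           (trans (switch-untouchedʳ G (N⇒≢ v~u) (≢-sym (Y⇒≢v y∈Y)) (N⇒≢ w₂∈N) (N⇒≢ w₁∈N)) (N-sym w₂∈N))
           (trans (switch-at-u-fixes-v w₂∈W w₁≢v y∈Y) w₁∈N)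
           (trans (H-column z₁∈Out z₁∉Y) w₁~z₁)
           (switch-removes G u y w₂ w₁)
           (trans (H-row z₂∈Out z₂∉Y) (≁-sym z₁≁z₂))
    row : ∀ a → G' v a ≡ G v a
    row _ = trans (switch-untouchedˡ H (N⇒≢ w₂∈N) (≢-sym (Out⇒≢v z₂∈Out)) (N⇒≢ w₁∈N) (≢-sym (Out⇒≢v z₁∈Out)))
                  (switch-at-u-fixes-v w₂∈W w₁≢v y∈Y)
    on-N : ∀ {a b} → a ∈ N v → b ∈ N v → G' a b ≡ isPair a b u w₂ ∨ G a b
    on-N {a} {b} a∈N b∈N = begin
      G' a b
        ≡⟨ switch-∌yz H (N∧Out⇒≢ a∈N z₂∈Out) (N∧Out⇒≢ b∈N z₂∈Out)
                        (N∧Out⇒≢ a∈N z₁∈Out) (N∧Out⇒≢ b∈N z₁∈Out) ⟩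
      isPair a b w₂ w₁ ∨ H a b
        ≡⟨ cong (isPair a b w₂ w₁ ∨_) (switch-∌y G (≢y a∈N) (≢y b∈N)) ⟩
      isPair a b w₂ w₁ ∨ (if isPair a b w₂ w₁ then false else isPair a b u w₂ ∨ G a b)
        ≡⟨ ∨-if-restore (λ pair → trans (cong (isPair a b u w₂ ∨_) (isPair-adj pair (N-sym w₁~w₂)))
                                        (∨-zeroʳ (isPair a b u w₂))) ⟩
      isPair a b u w₂ ∨ G a b ∎
      where open ≡-Reasoning

  W-nonempty : 2 ≤ d → ∃ (_∈ W)
  W-nonempty 2≤d = ∣p∣>0⇒nonempty W (≤-pred (subst (2 ≤_) (sym 1+∣W∣≡d) 2≤d))

  Y-nonempty : 2 ≤ d → ∃ (_∈ Y)
  Y-nonempty 2≤d = ∣p∣>0⇒nonempty Y (≤-pred (subst (2 ≤_) (sym 1+∣Y∣≡d) 2≤d))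

  W-other : 3 ≤ d → ∀ {w} → w ∈ W → ∃ λ w′ → w′ ∈ W × w′ ≢ w
  W-other 3≤d {w} w∈W with ∣p∣>0⇒nonempty (W - w) (≤-pred (≤-pred (subst (3 ≤_) (sym 2+∣W-w∣≡d) 3≤d)))
    where
    2+∣W-w∣≡d : suc (suc ∣ W - w ∣) ≡ d
    2+∣W-w∣≡d = trans (cong suc (sym (x∈p⇒∣p∣≡1+∣p-x∣ W w∈W))) 1+∣W∣≡d
  ... | w′ , w′∈W-w = w′ , p-x⊆p W w w′ w′∈W-w , x∈p-y⇒x≢y W w w′∈W-w

  N-v⊆Out : ∀ {w} → w ∈ W → (∀ w′ → w′ ∈ W → w′ ∉ N w) → N w - v ⊆ Out
  N-v⊆Out {w} w∈W no-W-neighbour b h with vertex-cases b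
  ... | inj₁ b≡v                 = contradiction b≡v (x∈p-y⇒x≢y (N w) v h)
  ... | inj₂ (inj₁ refl)         = contradiction (N-sym (p-x⊆p (N w) v u h)) (N[v]∩N[u]≡∅ (W⊆N w w∈W))
  ... | inj₂ (inj₂ (inj₁ b∈W))   = contradiction (p-x⊆p (N w) v b h) (no-W-neighbour b b∈W)
  ... | inj₂ (inj₂ (inj₂ b∈Out)) = b∈Out

  -- Otherwise z, v and all of Y are d + 1 neighbours of w.
  Y-has-non-neighbour : ∀ {w z} → OuterEdge w z → z ∉ Y → ∃ λ y → y ∈ Y × G y w ≡ false
  Y-has-non-neighbour {w} {z} (w∈W , w~z , z∈Out) z∉Y with any? (λ y → y ∈? Y ×-dec G y w ≟ᵇ false)
  ... | yes found = found
  ... | no  ∄ = contradiction (subst (_≤ d) ∣S∣≡1+d (∣p∣≤d S S⊆N[w])) (n≮n d)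
    where
    S : VSet n
    S = ⁅ z ⁆ ∪ ⁅ v ⁆ ∪ Y
    S⊆N[w] : S ⊆ N w
    S⊆N[w] = ∪-⊆ ⁅ z ⁆ (⁅ v ⁆ ∪ Y) (N w) (⁅x⁆⊆p (N w) w~z)
               (∪-⊆ ⁅ v ⁆ Y (N w) (⁅x⁆⊆p (N w) (N-sym (W⊆N w w∈W)))
                 λ y y∈Y → N-sym (¬-not λ y≁w → ∄ (y , y∈Y , y≁w)))
    z∉⁅v⁆∪Y : z ∉ ⁅ v ⁆ ∪ Y
    z∉⁅v⁆∪Y h = case x∈p∪q⁻ ⁅ v ⁆ Y h of λ where
      (inj₁ z≡v) → Out⇒≢v z∈Out (x∈⁅y⁆⇒x≡y v z≡v)
      (inj₂ z∈Y) → z∉Y z∈Y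
    ∣S∣≡1+d : ∣ S ∣ ≡ suc d
    ∣S∣≡1+d = begin
      ∣ S ∣                 ≡⟨ x∉p⇒∣⁅x⁆∪p∣≡1+∣p∣ (⁅ v ⁆ ∪ Y) z∉⁅v⁆∪Y ⟩
      suc ∣ ⁅ v ⁆ ∪ Y ∣     ≡⟨ cong suc (x∉p⇒∣⁅x⁆∪p∣≡1+∣p∣ Y (λ v∈Y → Y⇒≢v v∈Y refl)) ⟩
      suc (suc ∣ Y ∣)       ≡⟨ cong suc 1+∣Y∣≡d ⟩
      suc d                 ∎
      where open ≡-Reasoning

  SingleSwitch : Set
  SingleSwitch = ∃ λ w → ∃ λ z → ∃ λ y → OuterEdge w z × y ∈ Y × y ≢ z × G y z ≡ false

  single-switch? : Dec SingleSwitch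
  single-switch? = any? λ w → any? λ z → any? λ y →
    (w ∈? W ×-dec z ∈? N w ×-dec z ∈? Out) ×-dec y ∈? Y ×-dec ¬? (y ≟ z) ×-dec G y z ≟ᵇ false

  module NoSingleSwitch (no-single : ¬ SingleSwitch) where

    Y-z⊆N-outer : ∀ {w z y} → OuterEdge w z → y ∈ Y → y ≢ z → y ∈ N z
    Y-z⊆N-outer {w} {z} {y} e y∈Y y≢z = N-sym (¬-not λ y≁z → no-single (w , z , y , e , y∈Y , y≢z , y≁z))

    -- The vertices of Y − z, together with w and (if z ∈ Y) u, already are d neighbours of z.
    N-outer⊆ : ∀ {w z} → OuterEdge w z → N z ⊆ ⁅ w ⁆ ∪ ⁅ u ⁆ ∪ Y
    N-outer⊆ {w} {z} e@(w∈W , w~z , _) a a~z with z ∈? Y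
    ... | yes z∈Y = ∪-monoʳ ⁅ w ⁆ (⁅ u ⁆ ∪ Y - z) (⁅ u ⁆ ∪ Y)
                                  (∪-monoʳ ⁅ u ⁆ (Y - z) Y (p-x⊆p Y z)) a
                                  (N-saturated S S⊆N (≤-reflexive d≡∣S∣) a a~z)
      where
      S : VSet n
      S = ⁅ w ⁆ ∪ ⁅ u ⁆ ∪ Y - z
      S⊆N : S ⊆ N z
      S⊆N = ∪-⊆ ⁅ w ⁆ (⁅ u ⁆ ∪ Y - z) (N z) (⁅x⁆⊆p (N z) (N-sym w~z))
              (∪-⊆ ⁅ u ⁆ (Y - z) (N z) (⁅x⁆⊆p (N z) (N-sym (Y⊆N z z∈Y)))
                λ y y∈Y-z → Y-z⊆N-outer e (p-x⊆p Y z y y∈Y-z) (x∈p-y⇒x≢y Y z y∈Y-z))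
      w∉⁅u⁆∪Y-z : w ∉ ⁅ u ⁆ ∪ Y - z
      w∉⁅u⁆∪Y-z h = case x∈p∪q⁻ {x = w} ⁅ u ⁆ (Y - z) h of λ where
        (inj₁ w≡u) → W⇒≢u w∈W (x∈⁅y⁆⇒x≡y u w≡u)
        (inj₂ w∈Y) → W⇒∉Y w∈W (p-x⊆p Y z w w∈Y)
      d≡∣S∣ : d ≡ ∣ S ∣
      d≡∣S∣ = begin
        d                         ≡⟨ 1+∣Y∣≡d ⟨
        suc ∣ Y ∣                 ≡⟨ cong suc (x∈p⇒∣p∣≡1+∣p-x∣ Y z∈Y) ⟩
        suc (suc ∣ Y - z ∣)       ≡⟨ cong suc (x∉p⇒∣⁅x⁆∪p∣≡1+∣p∣ (Y - z) (λ u∈Y-z → N-irrefl (Y⊆N u (p-x⊆p Y z u u∈Y-z)))) ⟨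
        suc ∣ ⁅ u ⁆ ∪ Y - z ∣     ≡⟨ x∉p⇒∣⁅x⁆∪p∣≡1+∣p∣ (⁅ u ⁆ ∪ Y - z) w∉⁅u⁆∪Y-z ⟨
        ∣ S ∣                     ∎
        where open ≡-Reasoning
    ... | no z∉Y = ∪-monoʳ ⁅ w ⁆ Y (⁅ u ⁆ ∪ Y) (q⊆p∪q ⁅ u ⁆ Y) a
                                 (N-saturated (⁅ w ⁆ ∪ Y) S⊆N (≤-reflexive d≡∣S∣) a a~z)
      where
      S⊆N : ⁅ w ⁆ ∪ Y ⊆ N z
      S⊆N = ∪-⊆ ⁅ w ⁆ Y (N z) (⁅x⁆⊆p (N z) (N-sym w~z))
              λ y y∈Y → Y-z⊆N-outer e y∈Y (x∈p∧y∉p⇒x≢y Y y∈Y z∉Y)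
      d≡∣S∣ : d ≡ ∣ ⁅ w ⁆ ∪ Y ∣
      d≡∣S∣ = trans (sym 1+∣Y∣≡d) (sym (x∉p⇒∣⁅x⁆∪p∣≡1+∣p∣ Y (W⇒∉Y w∈W)))

    N-outer∖Y : ∀ {w z a} → OuterEdge w z → a ∈ N z → a ∉ Y → a ≡ w ⊎ a ≡ u
    N-outer∖Y {w} {z} {a} e a~z a∉Y with x∈p∪q⁻ {x = a} ⁅ w ⁆ (⁅ u ⁆ ∪ Y) (N-outer⊆ e a a~z)
    ... | inj₁ a≡w = inj₁ (x∈⁅y⁆⇒x≡y w a≡w)
    ... | inj₂ h with x∈p∪q⁻ {x = a} ⁅ u ⁆ Y h
    ...   | inj₁ a≡u = inj₂ (x∈⁅y⁆⇒x≡y u a≡u)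
    ...   | inj₂ a∈Y = contradiction a∈Y a∉Y

    N-outer∩Out⊆Y : ∀ {w z a} → OuterEdge w z → a ∈ N z → a ∈ Out → a ∈ Y
    N-outer∩Out⊆Y {a = a} e@(w∈W , _ , _) a~z a∈Out with a ∈? Y
    ... | yes a∈Y = a∈Y
    ... | no  a∉Y with N-outer∖Y e a~z a∉Y
    ...   | inj₁ refl = contradiction (W⊆N a w∈W) (Out⇒∉N a∈Out)
    ...   | inj₂ refl = contradiction v~u (Out⇒∉N a∈Out)

    outer-injective : ∀ {w w′ z} → OuterEdge w z → OuterEdge w′ z → w′ ≡ w
    outer-injective e (w′∈W , w′~z , _) with N-outer∖Y e (N-sym w′~z) (W⇒∉Y w′∈W)
    ... | inj₁ w′≡w = w′≡w
    ... | inj₂ w′≡u = contradiction w′≡u (W⇒≢u w′∈W)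

    outer∈Y-transfer : ∀ {w z w′ z′} → OuterEdge w z → z ∈ Y → OuterEdge w′ z′ → z′ ∈ Y
    outer∈Y-transfer {z = z} {z′ = z′} e z∈Y e′@(_ , _ , z′∈Out) with z′ ∈? Y
    ... | yes z′∈Y = z′∈Y
    ... | no  z′∉Y = N-outer∩Out⊆Y e (N-sym (Y-z⊆N-outer e′ z∈Y (x∈p∧y∉p⇒x≢y Y z∈Y z′∉Y))) z′∈Out

    module AllOuterInY (outer⊆Y : ∀ {w z} → OuterEdge w z → z ∈ Y) where

      -- Otherwise taking an outer neighbour injects W into Y − y.
      Y-has-W-neighbour : ∀ {y} → y ∈ Y → ∃ λ w → w ∈ W × y ∈ N w
      Y-has-W-neighbour {y} y∈Y with any? (λ w → w ∈? W ×-dec y ∈? N w)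
      ... | yes found = found
      ... | no  ∄ = contradiction (begin-strict
            ∣ Y - y ∣      <⟨ n<1+n ∣ Y - y ∣ ⟩
            suc ∣ Y - y ∣  ≡⟨ x∈p⇒∣p∣≡1+∣p-x∣ Y y∈Y ⟨
            ∣ Y ∣          ≡⟨ ∣W∣≡∣Y∣ ⟨
            ∣ W ∣          ≤⟨ ∣p∣≤∣q∣-injection W (Y - y) (λ _ → outer) outer∈Y-y outer-inj ⟩
            ∣ Y - y ∣      ∎) (n≮n ∣ Y - y ∣)
        where
        open ≤-Reasoning
        outer∈Y-y : ∀ w (w∈W : w ∈ W) → outer w∈W ∈ Y - y
        outer∈Y-y w w∈W = x∈p∧x≢y⇒x∈p-y Y (outer⊆Y (outer-edge w∈W))
          λ z≡y → ∄ (w , w∈W , subst (_∈ N w) z≡y (proj₁ (proj₂ (outer-edge w∈W))))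
        outer-inj : ∀ w w′ (w∈W : w ∈ W) (w′∈W : w′ ∈ W) → outer w∈W ≡ outer w′∈W → w ≡ w′
        outer-inj w w′ w∈W w′∈W eq =
          outer-injective (outer-edge w′∈W) (subst (OuterEdge w) eq (outer-edge w∈W))

      S : VSet n
      S = N[v] ∪ Y

      N⊆S : N v ⊆ S
      N⊆S a = p⊆p∪q N[v] Y a ∘ q⊆p∪q ⁅ v ⁆ (N v) a

      v∈S : v ∈ S
      v∈S = p⊆p∪q N[v] Y v (p⊆p∪q ⁅ v ⁆ (N v) v (x∈⁅x⁆ v))

      S-closed : Closed G S
      S-closed {b} {c} b∈S b~c with x∈p∪q⁻ {x = b} N[v] Y b∈S
      ... | inj₂ b∈Y with Y-has-W-neighbour b∈Y
      ...   | w , w∈W , w~b = ∪-⊆ ⁅ w ⁆ (⁅ u ⁆ ∪ Y) S (⁅x⁆⊆p S (N⊆S w (W⊆N w w∈W)))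
                                (∪-⊆ ⁅ u ⁆ Y S (⁅x⁆⊆p S (N⊆S u v~u)) (q⊆p∪q N[v] Y))
                                c (N-outer⊆ (w∈W , w~b , Y⊆Out b b∈Y) c b~c)
      S-closed {b} {c} b∈S b~c | inj₁ b∈N[v] with vertex-cases b
      ... | inj₁ refl = N⊆S c b~c
      ... | inj₂ (inj₁ refl) with v ≟ c
      ...   | yes refl = v∈S
      ...   | no  v≢c  = q⊆p∪q N[v] Y c (x∈p∧x≢y⇒x∈p-y (N u) b~c (≢-sym v≢c))
      S-closed {b} {c} b∈S b~c | inj₁ b∈N[v] | inj₂ (inj₂ (inj₁ b∈W)) with c ∈? Out
      ...   | yes c∈Out = q⊆p∪q N[v] Y c (outer⊆Y (b∈W , b~c , c∈Out))
      ...   | no  c∉Out = p⊆p∪q N[v] Y c (x∉∁p⇒x∈p N[v] c∉Out)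
      S-closed {b} {c} b∈S b~c | inj₁ b∈N[v] | inj₂ (inj₂ (inj₂ b∈Out)) =
        contradiction b∈N[v] (x∈∁p⇒x∉p N[v] b∈Out)

      component-too-small : ¬ CompAtLeast G v (2 * (d + 1))
      component-too-small component = <⇒≱ ∣S∣<2[d+1] (CompAtLeast⇒≤∣closed∣ S component S-closed v∈S)
        where
        open ≤-Reasoning
        ∣S∣<2[d+1] : ∣ S ∣ < 2 * (d + 1)
        ∣S∣<2[d+1] = begin-strict
          ∣ S ∣                ≤⟨ ∣p∪q∣≤∣p∣+∣q∣ N[v] Y ⟩
          ∣ N[v] ∣ + ∣ Y ∣     ≤⟨ +-monoˡ-≤ ∣ Y ∣ (∣⁅x⁆∪p∣≤1+∣p∣ v (N v)) ⟩
          suc ∣ N v ∣ + ∣ Y ∣  ≡⟨ cong (λ k → suc k + ∣ Y ∣) (∣N∣≡d v) ⟩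
          suc d + ∣ Y ∣        <⟨ 1+m+k<2[m+1] 1+∣Y∣≡d ⟩
          2 * (d + 1)          ∎

    module AllOuterOutsideY (outer∉Y : ∀ {w z} → OuterEdge w z → z ∉ Y) where

      Y⊆N-outer : ∀ {w z y} → OuterEdge w z → y ∈ Y → y ∈ N z
      Y⊆N-outer e y∈Y = Y-z⊆N-outer e y∈Y (x∈p∧y∉p⇒x≢y Y y∈Y (outer∉Y e))

      -- Otherwise the neighbours of w other than v are outer, hence adjacent to any y ∈ Y;
      -- together with u and an outer neighbour of another vertex of W they are d + 1 neighbours of y.
      W-has-W-neighbour : 3 ≤ d → ∀ {w} → w ∈ W → ∃ λ w′ → w′ ∈ W × w′ ∈ N w
      W-has-W-neighbour 3≤d {w} w∈W with any? (λ w′ → w′ ∈? W ×-dec w′ ∈? N w)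
      ... | yes found = found
      ... | no  ∄ with Y-nonempty (≤-trans (n≤1+n 2) 3≤d) | W-other 3≤d w∈W
      ...   | y , y∈Y | w′ , w′∈W , w′≢w =
        contradiction (subst (_≤ d) ∣S∣≡1+d (∣p∣≤d S S⊆N[y])) (n≮n d)
        where
        z′ : Fin n
        z′ = outer w′∈W
        e′ : OuterEdge w′ z′
        e′ = outer-edge w′∈W
        S : VSet n
        S = ⁅ z′ ⁆ ∪ ⁅ u ⁆ ∪ N w - v
        Nw-v⊆Out : N w - v ⊆ Out
        Nw-v⊆Out = N-v⊆Out w∈W λ w′ w′∈W w′∈N → ∄ (w′ , w′∈W , w′∈N)
        Nw-v⊆N[y] : N w - v ⊆ N y
        Nw-v⊆N[y] b h = N-sym (Y⊆N-outer (w∈W , p-x⊆p (N w) v b h , Nw-v⊆Out b h) y∈Y)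
        S⊆N[y] : S ⊆ N y
        S⊆N[y] = ∪-⊆ ⁅ z′ ⁆ (⁅ u ⁆ ∪ N w - v) (N y) (⁅x⁆⊆p (N y) (N-sym (Y⊆N-outer e′ y∈Y)))
                   (∪-⊆ ⁅ u ⁆ (N w - v) (N y) (⁅x⁆⊆p (N y) (N-sym (Y⊆N y y∈Y))) Nw-v⊆N[y])
        u∉Nw-v : u ∉ N w - v
        u∉Nw-v h = N[v]∩N[u]≡∅ (W⊆N w w∈W) (N-sym (p-x⊆p (N w) v u h))
        z′∉⁅u⁆∪Nw-v : z′ ∉ ⁅ u ⁆ ∪ N w - v
        z′∉⁅u⁆∪Nw-v h with x∈p∪q⁻ {x = z′} ⁅ u ⁆ (N w - v) h
        ... | inj₁ z′≡u = N∧Out⇒≢ v~u (proj₂ (proj₂ e′)) (sym (x∈⁅y⁆⇒x≡y u z′≡u))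
        ... | inj₂ z′∈Nw-v with N-outer∖Y e′ (N-sym (p-x⊆p (N w) v z′ z′∈Nw-v)) (W⇒∉Y w∈W)
        ...   | inj₁ w≡w′ = w′≢w (sym w≡w′)
        ...   | inj₂ w≡u  = W⇒≢u w∈W w≡u
        ∣S∣≡1+d : ∣ S ∣ ≡ suc d
        ∣S∣≡1+d = begin
          ∣ S ∣                        ≡⟨ x∉p⇒∣⁅x⁆∪p∣≡1+∣p∣ (⁅ u ⁆ ∪ N w - v) z′∉⁅u⁆∪Nw-v ⟩
          suc ∣ ⁅ u ⁆ ∪ N w - v ∣      ≡⟨ cong suc (x∉p⇒∣⁅x⁆∪p∣≡1+∣p∣ (N w - v) u∉Nw-v) ⟩
          suc (suc ∣ N w - v ∣)        ≡⟨ cong suc (x∈p⇒∣p∣≡1+∣p-x∣ (N w) (N-sym (W⊆N w w∈W))) ⟨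
          suc ∣ N w ∣                  ≡⟨ cong suc (∣N∣≡d w) ⟩
          suc d                        ∎
          where open ≡-Reasoning

      outer-distinct : ∀ {w₁ z₁ w₂ z₂} → OuterEdge w₁ z₁ → OuterEdge w₂ z₂ → w₂ ∈ N w₁ → z₁ ≢ z₂
      outer-distinct e₁ e₂ w₁~w₂ refl = N⇒≢ w₁~w₂ (sym (outer-injective e₁ e₂))

      outer-nonadjacent : ∀ {w₁ z₁ w₂ z₂} → OuterEdge w₁ z₁ → OuterEdge w₂ z₂ → G z₁ z₂ ≡ false
      outer-nonadjacent e₁ e₂@(_ , _ , z₂∈Out) =
        ¬-not λ z₁~z₂ → outer∉Y e₂ (N-outer∩Out⊆Y e₁ z₁~z₂ z₂∈Out)

      insertion-by-two-switches : 3 ≤ d → Insertion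
      insertion-by-two-switches 3≤d =
        let w₁ , w₁∈W         = W-nonempty (≤-trans (n≤1+n 2) 3≤d)
            z₁ , e₁           = outer-exists w₁∈W
            w₂ , w₂∈W , w₁~w₂ = W-has-W-neighbour 3≤d w₁∈W
            z₂ , e₂           = outer-exists w₂∈W
            y , y∈Y , y≁w₁    = Y-has-non-neighbour e₁ (outer∉Y e₁)
        in double-switch e₁ e₂ w₁~w₂ (outer∉Y e₁) (outer∉Y e₂)
             (outer-distinct e₁ e₂ w₁~w₂) (outer-nonadjacent e₁ e₂) y∈Y y≁w₁

    insertion-without-single-switch : 3 ≤ d → CompAtLeast G v (2 * (d + 1)) → Insertion
    insertion-without-single-switch 3≤d component
      with outer-exists (proj₂ (W-nonempty (≤-trans (n≤1+n 2) 3≤d)))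
    ... | z₁ , e₁ with z₁ ∈? Y
    ...   | yes z₁∈Y = contradiction component
                         (AllOuterInY.component-too-small λ e → outer∈Y-transfer e₁ z₁∈Y e)
    ...   | no  z₁∉Y = AllOuterOutsideY.insertion-by-two-switches
                         (λ e z∈Y → z₁∉Y (outer∈Y-transfer e z∈Y e₁)) 3≤d

  insertion-exists : 3 ≤ d → CompAtLeast G v (2 * (d + 1)) → Insertion
  insertion-exists 3≤d component with single-switch?
  ... | yes (_ , _ , _ , e , y∈Y , y≢z , y≁z) = single-switch e y∈Y y≢z y≁z
  ... | no  no-single = NoSingleSwitch.insertion-without-single-switch no-single 3≤d component

lemma3p3 : (d n : ℕ) → d ≥ 3 → (G : Adj n) → IsSimple G → Regular d G →
    (v : Fin n) → CompAtLeast G v (2 * (d + 1)) →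
    (u : Fin n) → G v u ≡ true →
    (∀ a → G v a ≡ true → G u a ≡ false) →
    Σ (Adj n) λ G' → AtMostTwoΔ G G' ×
      (∀ a → G' v a ≡ G v a) ×
      Σ (Fin n) λ w → G v w ≡ true × w ≢ u ×
        (∀ a b → G v a ≡ true → G v b ≡ true →
          (G' a b ≡ true ⇔ (G a b ≡ true ⊎ isPair a b u w ≡ true)))
lemma3p3 d n 3≤d G simple regular v component u v~u u-isolated =
  IsolatedNeighbour.insertion-exists G simple regular v u v~u u-isolated 3≤d component
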